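{- Let $Y$ be a connected finite simple undirected graph with vertex set $\{1,\dots,n\}$, let $\pi\in S_Y$, and let $g,g'\in C_n$ with $g\neq g'$. Then $[g\cdot\pi]_Y\neq[g'\cdot\pi]_Y$.
   Context: $S_Y$ denotes the set of permutations (total orders) $\pi=(\pi_1,\dots,\pi_n)$ of the vertex set of $Y$. The update graph $U(Y)$ has vertex set $S_Y$, and two permutations are adjacent if they differ exactly by swapping two consecutive entries $\pi_k,\pi_{k+1}$ with $\{\pi_k,\pi_{k+1}\}$ not an edge of $Y$. Write $\pi\sim_Y\pi'$ if $\pi,\pi'$ lie in the same connected component of $U(Y)$, and $[\pi]_Y$ for the class of $\pi$. Let $\sigma=(n,n-1,\dots,2,1)\in S_n$ (cycle notation) and $C_n=\langle\sigma\rangle$. The group $S_n$ acts on $S_Y$ by $g\cdot(\pi_1,\dots,\pi_n)=(\pi_{g^{ -1}(1)},\dots,\pi_{g^{ -1}(n)})$; in particular $\sigma\cdot\pi=(\pi_2,\dots,\pi_n,\pi_1)$. -}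

module Defs where

open import Data.Nat using (ℕ; zero; suc)
open import Data.Fin using (Fin; toℕ)
open import Data.List using (List; []; _∷_; _++_; allFin)
open import Data.List.Relation.Binary.Permutation.Propositional using (_↭_)
open import Data.Empty using (⊥)
open import Relation.Nullary using (¬_)
open import Relation.Binary.Construct.Closure.ReflexiveTransitive using (Star)
open import Level using (0ℓ; suc)

-- A finite simple undirected graph on vertex set Fin n (vertices 1..n ~ 0..n-1):
-- an edge relation that is symmetric and irreflexive.
record Graph (n : ℕ) : Set₁ where
  field
    Edge      : Fin n → Fin n → Set
    symmetric : ∀ {u v} → Edge u v → Edge v u
    irrefl    : ∀ {u} → ¬ Edge u u
open Graph public

Connected : ∀ {n} → Graph n → Set
Connected {n} Y = ∀ (u v : Fin n) → Star (Edge Y) u v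

-- S_Y: total orders of the vertex set, as lists containing every vertex exactly once.
IsOrder : ∀ {n} → List (Fin n) → Set
IsOrder {n} π = π ↭ allFin n

-- Edge of the update graph U(Y): swap two consecutive entries that are not adjacent in Y.
data UStep {n} (Y : Graph n) : List (Fin n) → List (Fin n) → Set where
  swap : ∀ (xs ys : List (Fin n)) (a b : Fin n) → ¬ Edge Y a b →
         UStep Y (xs ++ a ∷ b ∷ ys) (xs ++ b ∷ a ∷ ys)

-- π ~_Y π' : same connected component of U(Y), i.e. [π]_Y = [π']_Y.
_~[_]_ : ∀ {n} → List (Fin n) → Graph n → List (Fin n) → Set
π ~[ Y ] π' = Star (UStep Y) π π'

-- σ · π = (π_2, …, π_n, π_1) : left rotation.
rotate : ∀ {A : Set} → List A → List A
rotate []       = []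
rotate (x ∷ xs) = xs ++ x ∷ []

rotate^ : ∀ {A : Set} → ℕ → List A → List A
rotate^ zero    π = π
rotate^ (suc k) π = rotate (rotate^ k π)

-- Two vertices u, v joined by an edge of Y can never be swapped by an update
-- step, so the order in which u and v occur is an invariant of the class [π]_Y.
-- If 0 < m < n, the rotation σ^m cuts π into two nonempty blocks A ++ B and
-- returns B ++ A. As Y is connected, some edge {x, y} has x in A and y in B;
-- x precedes y in A ++ B but follows it in B ++ A, so the two orders lie in
-- different classes.
module Submission where

open import Defs
open import Data.Nat using (ℕ; zero; suc; _+_; _∸_; _≤_; _<_)
open import Data.Nat.Properties
  using (m∸n+n≡m; m∸n≤m; m<n⇒0<n∸m; m≤n⇒m⊓n≡m; <-cmp; <⇒≤; ≤-<-trans)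
open import Data.Fin using (Fin; toℕ)
open import Data.Fin.Properties using (toℕ<n; toℕ-injective; _≟_)
open import Data.List using (List; []; _∷_; _++_; filter; take; drop; length)
open import Data.List.Properties
  using (++-assoc; ++-identityʳ; filter-++; filter-accept; filter-reject; length-take; length-drop; take++drop≡id;
         length-tabulate; ∷-injectiveˡ)
open import Data.List.Membership.Propositional using (_∈_)
open import Data.List.Membership.Propositional.Properties
  using (∈-++⁺ʳ; ∈-++⁻; ∈-filter⁺; ∈-filter⁻; ∈-allFin)
open import Data.List.Relation.Unary.Any using (here; there)
open import Data.List.Relation.Unary.All using (lookup)
open import Data.List.Relation.Unary.AllPairs using (_∷_)
open import Data.List.Relation.Unary.Unique.Propositional using (Unique)
open import Data.List.Relation.Unary.Unique.Propositional.Properties using (allFin⁺)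
open import Data.List.Relation.Binary.Disjoint.Propositional using (Disjoint)
open import Data.List.Relation.Binary.Permutation.Propositional using (_↭_; ↭-refl; ↭-trans; ↭-sym; ↭⇒↭ₛ)
open import Data.List.Relation.Binary.Permutation.Propositional.Properties
  using (∈-resp-↭; ↭-length; ++-comm)
open import Data.List.Relation.Binary.Permutation.Setoid.Properties using (Unique-resp-↭)
open import Data.Product using (∃; ∃₂; _×_; _,_; proj₁; proj₂)
open import Data.Sum using (inj₁; inj₂)
open import Data.Empty using (⊥-elim)
open import Level using (Level)
open import Relation.Nullary using (¬_; Dec; yes; no)
open import Relation.Unary using (Pred; Decidable)
open import Relation.Binary.PropositionalEquality
open import Relation.Binary.Definitions using (tri<; tri≈; tri>)
open import Relation.Binary.Construct.Closure.ReflexiveTransitive using (Star; ε; _◅_; reverse)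

private
  variable
    a p r : Level
    A : Set a

∈⇒nonempty : ∀ {w} {xs : List A} → w ∈ xs → ∃₂ λ x ys → xs ≡ x ∷ ys
∈⇒nonempty {xs = x ∷ ys} _ = x , ys , refl

0<length⇒∈ : ∀ {xs : List A} → 0 < length xs → ∃ (_∈ xs)
0<length⇒∈ {xs = x ∷ _} _ = x , here refl

Unique-++⇒Disjoint : ∀ (xs : List A) {ys} → Unique (xs ++ ys) → Disjoint xs ys
Unique-++⇒Disjoint (x ∷ xs) (x∉ ∷ _) (here refl , w∈ys) = lookup x∉ (∈-++⁺ʳ xs w∈ys) refl
Unique-++⇒Disjoint (x ∷ xs) (_ ∷ u)  (there w∈xs , w∈ys) = Unique-++⇒Disjoint xs u (w∈xs , w∈ys)

module _ {P : Pred A p} (P? : Decidable P) where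

  filter-++-swap-≢ : ∀ {xs ys v w} → Disjoint xs ys → v ∈ xs → P v → w ∈ ys → P w →
                     filter P? (xs ++ ys) ≢ filter P? (ys ++ xs)
  filter-++-swap-≢ {xs} {ys} xs#ys v∈xs Pv w∈ys Pw eq
    with ∈⇒nonempty (∈-filter⁺ P? v∈xs Pv) | ∈⇒nonempty (∈-filter⁺ P? w∈ys Pw)
  ... | x , xs′ , fxs | y , ys′ , fys = xs#ys (x∈xs , subst (_∈ ys) (sym x≡y) y∈ys)
    where
    x∈xs : x ∈ xs
    x∈xs = proj₁ (∈-filter⁻ P? (subst (x ∈_) (sym fxs) (here refl)))
    y∈ys : y ∈ ys
    y∈ys = proj₁ (∈-filter⁻ P? (subst (y ∈_) (sym fys) (here refl)))
    x≡y : x ≡ y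
    x≡y = ∷-injectiveˡ (begin
      x ∷ xs′ ++ filter P? ys          ≡⟨ cong (_++ filter P? ys) fxs ⟨
      filter P? xs ++ filter P? ys     ≡⟨ filter-++ P? xs ys ⟨
      filter P? (xs ++ ys)             ≡⟨ eq ⟩
      filter P? (ys ++ xs)             ≡⟨ filter-++ P? ys xs ⟩
      filter P? ys ++ filter P? xs     ≡⟨ cong (_++ filter P? xs) fys ⟩
      y ∷ ys′ ++ filter P? xs          ∎)
      where open ≡-Reasoning

  Star⇒crossing : ∀ {R : A → A → Set r} {x y} → Star R x y → P x → ¬ P y →
                  ∃₂ λ u v → R u v × P u × ¬ P v
  Star⇒crossing ε Px ¬Py = ⊥-elim (¬Py Px)
  Star⇒crossing {x = x} (_◅_ {j = z} xRz z⋆y) Px ¬Py with P? z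
  ... | yes Pz = Star⇒crossing z⋆y Pz ¬Py
  ... | no ¬Pz = x , z , xRz , Px , ¬Pz

rotate^-suc : ∀ m (xs : List A) → rotate^ (suc m) xs ≡ rotate^ m (rotate xs)
rotate^-suc zero    xs = refl
rotate^-suc (suc m) xs = cong rotate (rotate^-suc m xs)

rotate^-+ : ∀ m k (xs : List A) → rotate^ (m + k) xs ≡ rotate^ m (rotate^ k xs)
rotate^-+ zero    k xs = refl
rotate^-+ (suc m) k xs = cong rotate (rotate^-+ m k xs)

rotate^-++ : ∀ (xs ys : List A) → rotate^ (length xs) (xs ++ ys) ≡ ys ++ xs
rotate^-++ []       ys = sym (++-identityʳ ys)
rotate^-++ (x ∷ xs) ys = begin
  rotate^ (suc (length xs)) (x ∷ xs ++ ys)   ≡⟨ rotate^-suc (length xs) (x ∷ xs ++ ys) ⟩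
  rotate^ (length xs) ((xs ++ ys) ++ x ∷ [])  ≡⟨ cong (rotate^ (length xs)) (++-assoc xs ys (x ∷ [])) ⟩
  rotate^ (length xs) (xs ++ ys ++ x ∷ [])    ≡⟨ rotate^-++ xs (ys ++ x ∷ []) ⟩
  (ys ++ x ∷ []) ++ xs                        ≡⟨ ++-assoc ys (x ∷ []) xs ⟩
  ys ++ x ∷ xs                                ∎
  where open ≡-Reasoning

rotate^-↭ : ∀ k (xs : List A) → rotate^ k xs ↭ xs
rotate^-↭ zero    xs = ↭-refl
rotate^-↭ (suc k) xs = ↭-trans (rotate-↭ (rotate^ k xs)) (rotate^-↭ k xs)
  where
  rotate-↭ : ∀ (ys : List A) → rotate ys ↭ ys
  rotate-↭ []       = ↭-refl
  rotate-↭ (y ∷ ys) = ++-comm ys (y ∷ [])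

rotate^-take-drop : ∀ m (xs : List A) → m ≤ length xs → rotate^ m xs ≡ drop m xs ++ take m xs
rotate^-take-drop m xs m≤ = begin
  rotate^ m xs                                    ≡⟨ cong (rotate^ m) (take++drop≡id m xs) ⟨
  rotate^ m (take m xs ++ drop m xs)              ≡⟨ cong (λ k → rotate^ k (take m xs ++ drop m xs)) length-take-m ⟨
  rotate^ (length (take m xs)) (take m xs ++ drop m xs) ≡⟨ rotate^-++ (take m xs) (drop m xs) ⟩
  drop m xs ++ take m xs                          ∎
  where
  open ≡-Reasoning
  length-take-m : length (take m xs) ≡ m
  length-take-m = trans (length-take m xs) (m≤n⇒m⊓n≡m m≤)

module _ {n : ℕ} where

  IsOrder⇒length : ∀ {π : List (Fin n)} → IsOrder π → length π ≡ n
  IsOrder⇒length ord = trans (↭-length ord) (length-tabulate (λ i → i))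

  IsOrder⇒Unique : ∀ {π : List (Fin n)} → IsOrder π → Unique π
  IsOrder⇒Unique ord = Unique-resp-↭ (setoid (Fin n)) (↭⇒↭ₛ (↭-sym ord)) (allFin⁺ n)

  IsOrder⇒∈ : ∀ {π : List (Fin n)} → IsOrder π → ∀ v → v ∈ π
  IsOrder⇒∈ ord v = ∈-resp-↭ (↭-sym ord) (∈-allFin v)

  IsOrder-rotate^ : ∀ k {π : List (Fin n)} → IsOrder π → IsOrder (rotate^ k π)
  IsOrder-rotate^ k {π} ord = ↭-trans (rotate^-↭ k π) ord

module _ {n : ℕ} (Y : Graph n) where

  open import Data.List.Membership.DecPropositional (_≟_ {n}) using (_∈?_)

  ~-sym : ∀ {π π′} → π ~[ Y ] π′ → π′ ~[ Y ] π
  ~-sym = reverse UStep-sym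
    where
    UStep-sym : ∀ {π π′} → UStep Y π π′ → UStep Y π′ π
    UStep-sym (swap xs ys u v ¬uv) = swap xs ys v u (λ vu → ¬uv (symmetric Y vu))

  module _ {P : Pred (Fin n) p} (P? : Decidable P)
           (clique : ∀ {u v} → P u → P v → ¬ Edge Y u v → u ≡ v) where

    filter-swap : ∀ u v ys → ¬ Edge Y u v → filter P? (u ∷ v ∷ ys) ≡ filter P? (v ∷ u ∷ ys)
    filter-swap u v ys ¬uv = by-cases (P? u) (P? v)
      where
      by-cases : Dec (P u) → Dec (P v) → filter P? (u ∷ v ∷ ys) ≡ filter P? (v ∷ u ∷ ys)
      by-cases (yes Pu) (yes Pv) with refl ← clique Pu Pv ¬uv = refl
      by-cases (yes Pu) (no ¬Pv) = trans (trans (filter-accept P? Pu) (cong (u ∷_) (filter-reject P? ¬Pv)))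
                                         (sym (trans (filter-reject P? ¬Pv) (filter-accept P? Pu)))
      by-cases (no ¬Pu) (yes Pv) = trans (trans (filter-reject P? ¬Pu) (filter-accept P? Pv))
                                         (sym (trans (filter-accept P? Pv) (cong (v ∷_) (filter-reject P? ¬Pu))))
      by-cases (no ¬Pu) (no ¬Pv) = trans (trans (filter-reject P? ¬Pu) (filter-reject P? ¬Pv))
                                         (sym (trans (filter-reject P? ¬Pv) (filter-reject P? ¬Pu)))

    filter-UStep : ∀ {π π′} → UStep Y π π′ → filter P? π ≡ filter P? π′
    filter-UStep (swap xs ys u v ¬uv) = begin
      filter P? (xs ++ u ∷ v ∷ ys)              ≡⟨ filter-++ P? xs (u ∷ v ∷ ys) ⟩
      filter P? xs ++ filter P? (u ∷ v ∷ ys)    ≡⟨ cong (filter P? xs ++_) (filter-swap u v ys ¬uv) ⟩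
      filter P? xs ++ filter P? (v ∷ u ∷ ys)    ≡⟨ filter-++ P? xs (v ∷ u ∷ ys) ⟨
      filter P? (xs ++ v ∷ u ∷ ys)              ∎
      where open ≡-Reasoning

    filter-~ : ∀ {π π′} → π ~[ Y ] π′ → filter P? π ≡ filter P? π′
    filter-~ ε        = refl
    filter-~ (s ◅ ss) = trans (filter-UStep s) (filter-~ ss)

  edge-clique : ∀ {x y} → Edge Y x y → ∀ {u v} → u ∈ x ∷ y ∷ [] → v ∈ x ∷ y ∷ [] →
                ¬ Edge Y u v → u ≡ v
  edge-clique xy (here refl)         (here refl)         _   = refl
  edge-clique xy (here refl)         (there (here refl)) ¬xy = ⊥-elim (¬xy xy)
  edge-clique xy (there (here refl)) (here refl)         ¬yx = ⊥-elim (¬yx (symmetric Y xy))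
  edge-clique xy (there (here refl)) (there (here refl)) _   = refl

  swap-blocks-≁ : Connected Y → ∀ {xs ys v w} → Disjoint xs ys → (∀ u → u ∈ xs ++ ys) →
                  v ∈ xs → w ∈ ys → ¬ ((xs ++ ys) ~[ Y ] (ys ++ xs))
  swap-blocks-≁ conn {xs} {ys} {v} {w} xs#ys cover v∈xs w∈ys rel
    with Star⇒crossing (_∈? xs) (conn v w) v∈xs (λ w∈xs → xs#ys (w∈xs , w∈ys))
  ... | x , y , xy , x∈xs , y∉xs =
    filter-++-swap-≢ x∨y? xs#ys x∈xs (here refl) y∈ys (there (here refl))
      (filter-~ x∨y? (edge-clique xy) rel)
    where
    x∨y? : Decidable (_∈ x ∷ y ∷ [])
    x∨y? u = u ∈? x ∷ y ∷ []
    y∈ys : y ∈ ys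
    y∈ys with ∈-++⁻ xs (cover y)
    ... | inj₁ y∈xs = ⊥-elim (y∉xs y∈xs)
    ... | inj₂ y∈ys = y∈ys

  rotate^-≁ : Connected Y → ∀ {π} → IsOrder π → ∀ {m} → 0 < m → m < n →
              ¬ (π ~[ Y ] rotate^ m π)
  rotate^-≁ conn {π} ord {m} 0<m m<n rel =
    swap-blocks-≁ conn (Unique-++⇒Disjoint (take m π) (subst Unique (sym split) (IsOrder⇒Unique ord)))
      (λ u → subst (u ∈_) (sym split) (IsOrder⇒∈ ord u)) (proj₂ v∈take) (proj₂ w∈drop)
      (subst₂ _~[ Y ]_ (sym split) (rotate^-take-drop m π m≤length) rel)
    where
    split : take m π ++ drop m π ≡ π
    split = take++drop≡id m π
    m≤length : m ≤ length π
    m≤length = subst (m ≤_) (sym (IsOrder⇒length ord)) (<⇒≤ m<n)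
    v∈take : ∃ (_∈ take m π)
    v∈take = 0<length⇒∈ (subst (0 <_) (sym (trans (length-take m π) (m≤n⇒m⊓n≡m m≤length))) 0<m)
    w∈drop : ∃ (_∈ drop m π)
    w∈drop = 0<length⇒∈ (subst (0 <_) (sym (trans (length-drop m π) (cong (_∸ m) (IsOrder⇒length ord))))
                                       (m<n⇒0<n∸m m<n))

  rotate^-<-≁ : Connected Y → ∀ {π} → IsOrder π → ∀ {k l} → k < l → l < n →
                ¬ (rotate^ k π ~[ Y ] rotate^ l π)
  rotate^-<-≁ conn {π} ord {k} {l} k<l l<n rel =
    rotate^-≁ conn (IsOrder-rotate^ k ord) (m<n⇒0<n∸m k<l) (≤-<-trans (m∸n≤m l k) l<n)
      (subst (rotate^ k π ~[ Y ]_) rotate^-l rel)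
    where
    rotate^-l : rotate^ l π ≡ rotate^ (l ∸ k) (rotate^ k π)
    rotate^-l = trans (cong (λ j → rotate^ j π) (sym (m∸n+n≡m (<⇒≤ k<l)))) (rotate^-+ (l ∸ k) k π)

proposition1 : ∀ {n : ℕ} (Y : Graph n) → Connected Y →
                 (π : List (Fin n)) → IsOrder π →
                 (k l : Fin n) → ¬ (k ≡ l) →
                 ¬ (rotate^ (toℕ k) π ~[ Y ] rotate^ (toℕ l) π)
proposition1 Y conn π ord k l k≢l rel with <-cmp (toℕ k) (toℕ l)
... | tri< k<l _ _ = rotate^-<-≁ Y conn ord k<l (toℕ<n l) rel
... | tri≈ _ k≡l _ = k≢l (toℕ-injective k≡l)
... | tri> _ _ l<k = rotate^-<-≁ Y conn ord l<k (toℕ<n k) (~-sym Y rel)
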